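{- Run the single-commodity procedure described in the context on a source function $b\in\mathbb{R}^V$, and suppose that at some round $i$ we have $\langle\tilde\phi^i,b\rangle>\langle\tilde\phi^i,Bf^i\rangle$. For a real number $x$, define $V_{>x}=\{v\in V:\tilde\phi^i_v>x\}$ and $V_{<x}=\{v\in V:\tilde\phi^i_v<x\}$. Then there exists a set $S\subseteq V$ with $|b(S)|>\delta S$ of the form $S=V_{>x}$ for some $x\ge0$ or $S=V_{<x}$ for some $x\le0$.
   Context: $G=(V,E)$ is a unit-capacity undirected graph with $n=|V|$, each edge with a fixed arbitrary orientation $(u,v)$; $\deg(v)$ is the degree of $v$. The incidence matrix $B\in\mathbb{R}^{V\times E}$ has, in column $(u,v)$, entry $+1$ at row $u$, $-1$ at row $v$, $0$ elsewhere. For $b\in\mathbb{R}^V$ and $S\subseteq V$, $b(S)=\sum_{v\in S}b(v)$; $\delta S$ is the number of edges with exactly one endpoint in $S$. Single-commodity procedure: given $b\in\mathbb{R}^V$, a parameter $\alpha\le1/4$ and a number of rounds $T$, initialize weights $w^1_{v,+}=w^1_{v,- }=1$ for all $v$. In round $i=1,\dots,T$: (a) set rounded weights $\tilde w^i_{v,\pm}=w^i_{v,\pm}$ if $w^i_{v,\pm}\ge n$ and $\tilde w^i_{v,\pm}=0$ otherwise; (b) set rounded potentials $\tilde\phi^i_v=(\tilde w^i_{v,+}-\tilde w^i_{v,- })/\deg(v)$; (c) define the flow $f^i\in\mathbb{R}^E$ by $f^i(u,v)=+1$ if $\tilde\phi^i_u>\tilde\phi^i_v$, $-1$ if $\tilde\phi^i_u<\tilde\phi^i_v$,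 and $0$ otherwise; (d) if $\langle\tilde\phi^i,b\rangle>\langle\tilde\phi^i,Bf^i\rangle$, terminate; (e) set $r^i_v=(b(v)-(Bf^i)_v)/\deg(v)$; (f) update $w^{i+1}_{v,+}=w^i_{v,+}(1+\alpha r^i_v)$ and $w^{i+1}_{v,- }=w^i_{v,- }(1-\alpha r^i_v)$.
   Formalization: The source function b takes values in ℚ instead of ℝ, and the parameter α is rational. -}

module Defs where

open import Data.Nat using (ℕ; zero; suc)
open import Data.Integer using (+_)
open import Data.Fin using (Fin; zero; suc)
open import Data.Fin.Subset using (Subset)
open import Data.Vec using (lookup)
open import Data.Bool using (Bool; true; false; if_then_else_; _xor_; _∨_)
open import Data.Sum using (_⊎_)
open import Data.Product using (_×_; _,_; proj₁; proj₂)
open import Data.Rational using (ℚ; 0ℚ; 1ℚ; _+_; _-_; _*_; -_; _/_; _<_; _≤_)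
open import Data.Rational.Properties using (_<?_; _≤?_)
open import Relation.Binary.PropositionalEquality using (_≡_; _≢_)
open import Relation.Nullary using (¬_; does)

ℕ→ℚ : ℕ → ℚ
ℕ→ℚ k = + k / 1

Σ[_] : ∀ {n} → (Fin n → ℚ) → ℚ
Σ[_] {zero} f = 0ℚ
Σ[_] {suc n} f = f zero + Σ[ (λ i → f (suc i)) ]

count : ∀ {m} → (Fin m → Bool) → ℕ
count {zero} p = 0
count {suc m} p = (if p zero then 1 else 0) Data.Nat.+ count (λ i → p (suc i))

_==_ : ∀ {n} → Fin n → Fin n → Bool
zero == zero = true
zero == suc _ = false
suc _ == zero = false
suc i == suc j = i == j

-- A simple undirected graph on vertex set Fin n with m edges, each with a
-- fixed orientation (tail , head).
record Graph (n : ℕ) : Set where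
  field
    m      : ℕ
    edge   : Fin m → Fin n × Fin n
    noLoop : ∀ e → proj₁ (edge e) ≢ proj₂ (edge e)
    simple : ∀ e e' → e ≢ e' →
             ¬ ((proj₁ (edge e) ≡ proj₁ (edge e') × proj₂ (edge e) ≡ proj₂ (edge e'))
               ⊎ (proj₁ (edge e) ≡ proj₂ (edge e') × proj₂ (edge e) ≡ proj₁ (edge e')))

open Graph public

module _ {n : ℕ} (G : Graph n) where

  tl hd : Fin (m G) → Fin n
  tl e = proj₁ (edge G e)
  hd e = proj₂ (edge G e)

  deg : Fin n → ℕ
  deg v = count (λ e → (tl e == v) ∨ (hd e == v))

  -- Division by deg(v) (convention: division by 0 yields 0; only relevant
  -- for isolated vertices).
  divDeg : ℚ → Fin n → ℚ
  divDeg p v with deg v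
  ... | zero = 0ℚ
  ... | suc k = p * (+ 1 / suc k)

  Bmul : (Fin (m G) → ℚ) → Fin n → ℚ
  Bmul f v = sumE (λ e → f e * ((if tl e == v then 1ℚ else 0ℚ) - (if hd e == v then 1ℚ else 0ℚ)))
    where
    sumE : ∀ {k} → (Fin k → ℚ) → ℚ
    sumE = Σ[_]

  ⟪_,_⟫ : (Fin n → ℚ) → (Fin n → ℚ) → ℚ
  ⟪ x , y ⟫ = Σ[ (λ v → x v * y v) ]

  bOf : (Fin n → ℚ) → Subset n → ℚ
  bOf b S = Σ[ (λ v → if lookup S v then b v else 0ℚ) ]

  δ : Subset n → ℕ
  δ S = count (λ e → lookup S (tl e) xor lookup S (hd e))

  -- Weights (w_{v,+} , w_{v,-}).
  Weights : Set
  Weights = Fin n → ℚ × ℚ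

  round : ℚ → ℚ
  round w = if does (ℕ→ℚ n ≤? w) then w else 0ℚ

  potential : Weights → Fin n → ℚ
  potential w v = divDeg (round (proj₁ (w v)) - round (proj₂ (w v))) v

  flowOf : (Fin n → ℚ) → Fin (m G) → ℚ
  flowOf φ e =
    if does (φ (hd e) <? φ (tl e)) then 1ℚ
    else (if does (φ (tl e) <? φ (hd e)) then - 1ℚ else 0ℚ)

  module Procedure (b : Fin n → ℚ) (α : ℚ) where

    -- w i = w^{i+1} (rounds are 0-indexed here: index i is round i+1).
    w : ℕ → Weights
    φ̃ : ℕ → Fin n → ℚ
    f : ℕ → Fin (m G) → ℚ
    r : ℕ → Fin n → ℚ

    w zero v = 1ℚ , 1ℚ
    w (suc i) v = proj₁ (w i v) * (1ℚ + α * r i v) , proj₂ (w i v) * (1ℚ - α * r i v)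

    φ̃ i = potential (w i)
    f i = flowOf (φ̃ i)
    r i v = divDeg (b v - Bmul (f i) v) v

    Terminates : ℕ → Set
    Terminates i = ⟪ φ̃ i , Bmul (f i) ⟫ < ⟪ φ̃ i , b ⟫

  IsUpperLevel : (Fin n → ℚ) → ℚ → Subset n → Set
  IsUpperLevel φ x S = ∀ v → lookup S v ≡ does (x <? φ v)

  IsLowerLevel : (Fin n → ℚ) → ℚ → Subset n → Set
  IsLowerLevel φ x S = ∀ v → lookup S v ≡ does (φ v <? x)

{-# OPTIONS --safe #-}
module Submission where

-- ⟨φ, B f⟩ is the total variation Σₑ ∣φ(tl e) − φ(hd e)∣ of φ, so termination says that
-- φ is a certificate: its variation is smaller than ⟨φ, b⟩.  Both quantities are additive
-- along φ = φ⁺ − φ⁻, hence φ⁺ is a certificate for b or φ⁻ is one for −b; the upper level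
-- sets of φ⁻ are the lower level sets of φ.  A nonnegative certificate ψ is taken apart
-- layer by layer: if t is its least positive value and S = {ψ > 0}, lowering ψ by t on S
-- changes ⟨ψ, b⟩ − variation ψ by exactly t (b(S) − δS).  So either S is a violated cut,
-- or the lowered function is again a certificate, with smaller support and with the
-- level sets of ψ shifted by t.

open import Defs
open import Level using (0ℓ)
open import Function using (_∘_; id; _⇔_; mk⇔)
import Function.Properties.Equivalence as Equivalence
open import Data.Nat using (ℕ; zero; suc) renaming (_<_ to _<ℕ_)
open import Data.Nat.Induction using (<-wellFounded)
open import Induction.WellFounded using (Acc; acc)
open import Data.Fin using (Fin; zero; suc)
open import Data.Fin.Subset using (Subset; _∈_)
import Data.Fin.Subset as Subset
open import Data.Fin.Subset.Properties using (p⊂q⇒∣p∣<∣q∣)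
open import Data.Vec using (tabulate; lookup)
open import Data.Vec.Properties using (lookup∘tabulate; tabulate-cong; lookup⇒[]=; []=⇒lookup)
open import Data.Bool using (Bool; true; false; if_then_else_; _xor_)
open import Data.Product using (∃; _×_; _,_; proj₁; proj₂)
open import Data.Sum using (_⊎_; inj₁; inj₂)
import Data.Integer as ℤ
open import Data.Integer using (+_)
import Data.Integer.Properties as ℤ
open import Data.Nat.Coprimality using (1-coprimeTo) renaming (sym to coprime-sym)
open import Data.Rational
  using (ℚ; 0ℚ; 1ℚ; _+_; _-_; _*_; -_; _/_; ∣_∣; _⊔_; _<_; _≤_; nonNegative)
open import Data.Rational.Properties
open import Algebra.Bundles using (Ring)
open import Algebra.Properties.Semiring.Sum (Ring.semiring +-*-ring)
  using (sum; sum-cong-≗; ∑-distrib-+; ∑-comm; *-distribˡ-sum; sum-replicate-zero)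
open import Algebra.Properties.Ring +-*-ring using (-1*x≈-x; -‿involutive; ⁻¹-anti-homo‿-)
open import Relation.Binary.PropositionalEquality
  using (_≡_; refl; sym; trans; cong; cong₂; subst; subst₂; module ≡-Reasoning)
open import Relation.Nullary using (¬_; Dec; yes; no; does; contradiction)
open import Relation.Nullary.Decidable using (dec-true; does-⇔; dec⇒maybe)
open import Relation.Unary using (Decidable)
open import Tactic.RingSolver using (solve-∀)
open import Tactic.RingSolver.Core.AlmostCommutativeRing
  using (AlmostCommutativeRing; fromCommutativeRing)

ℚ-ring : AlmostCommutativeRing 0ℓ 0ℓ
ℚ-ring = fromCommutativeRing +-*-commutativeRing (λ p → dec⇒maybe (0ℚ ≟ p))

Σ≡sum : ∀ {k} (f : Fin k → ℚ) → Σ[ f ] ≡ sum f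
Σ≡sum {zero}  f = refl
Σ≡sum {suc k} f = cong (_+_ (f zero)) (Σ≡sum (f ∘ suc))

Σ-cong : ∀ {k} {f g : Fin k → ℚ} → (∀ i → f i ≡ g i) → Σ[ f ] ≡ Σ[ g ]
Σ-cong {f = f} {g} f≗g = trans (Σ≡sum f) (trans (sum-cong-≗ f≗g) (sym (Σ≡sum g)))

Σ-zero : ∀ {k} → Σ[ (λ (_ : Fin k) → 0ℚ) ] ≡ 0ℚ
Σ-zero {k} = trans (Σ≡sum {k} (λ _ → 0ℚ)) (sum-replicate-zero k)

Σ-distrib-+ : ∀ {k} (f g : Fin k → ℚ) → Σ[ (λ i → f i + g i) ] ≡ Σ[ f ] + Σ[ g ]
Σ-distrib-+ f g =
  trans (Σ≡sum (λ i → f i + g i)) (trans (∑-distrib-+ f g) (sym (cong₂ _+_ (Σ≡sum f) (Σ≡sum g))))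

*-distribˡ-Σ : ∀ {k} c (f : Fin k → ℚ) → c * Σ[ f ] ≡ Σ[ (λ i → c * f i) ]
*-distribˡ-Σ c f =
  trans (cong (c *_) (Σ≡sum f)) (trans (*-distribˡ-sum c f) (sym (Σ≡sum (λ i → c * f i))))

Σ-comm : ∀ {k l} (A : Fin k → Fin l → ℚ) →
         Σ[ (λ i → Σ[ A i ]) ] ≡ Σ[ (λ j → Σ[ (λ i → A i j) ]) ]
Σ-comm A = begin
  Σ[ (λ i → Σ[ A i ]) ]                 ≡⟨ Σ≡sum (λ i → Σ[ A i ]) ⟩
  sum (λ i → Σ[ A i ])                  ≡⟨ sum-cong-≗ (Σ≡sum ∘ A) ⟩
  sum (λ i → sum (A i))                 ≡⟨ ∑-comm A ⟩
  sum (λ j → sum (λ i → A i j))         ≡⟨ sum-cong-≗ (λ j → Σ≡sum (λ i → A i j)) ⟨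
  sum (λ j → Σ[ (λ i → A i j) ])        ≡⟨ Σ≡sum (λ j → Σ[ (λ i → A i j) ]) ⟨
  Σ[ (λ j → Σ[ (λ i → A i j) ]) ]       ∎
  where open ≡-Reasoning

Σ-neg : ∀ {k} (f : Fin k → ℚ) → Σ[ (λ i → - f i) ] ≡ - Σ[ f ]
Σ-neg f =
  trans (Σ-cong (sym ∘ -1*x≈-x ∘ f)) (trans (sym (*-distribˡ-Σ (- 1ℚ) f)) (-1*x≈-x Σ[ f ]))

Σ-+-* : ∀ {k} (f : Fin k → ℚ) c (g : Fin k → ℚ) → Σ[ (λ i → f i + c * g i) ] ≡ Σ[ f ] + c * Σ[ g ]
Σ-+-* f c g =
  trans (Σ-distrib-+ f (λ i → c * g i)) (cong (_+_ Σ[ f ]) (sym (*-distribˡ-Σ c g)))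

Σ-indicator : ∀ {k} (f : Fin k → ℚ) (u : Fin k) →
              Σ[ (λ v → f v * (if u == v then 1ℚ else 0ℚ)) ] ≡ f u
Σ-indicator {suc k} f zero = begin
  f zero * 1ℚ + Σ[ (λ v → f (suc v) * 0ℚ) ]
    ≡⟨ cong₂ _+_ (*-identityʳ (f zero)) (Σ-cong (*-zeroʳ ∘ f ∘ suc)) ⟩
  f zero + Σ[ (λ (_ : Fin k) → 0ℚ) ]
    ≡⟨ cong (_+_ (f zero)) (Σ-zero {k}) ⟩
  f zero + 0ℚ
    ≡⟨ +-identityʳ (f zero) ⟩
  f zero ∎
  where open ≡-Reasoning
Σ-indicator {suc k} f (suc u) =
  trans (cong (_+ Σ[ g ]) (*-zeroʳ (f zero))) (trans (+-identityˡ Σ[ g ]) (Σ-indicator (f ∘ suc) u))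
  where
  g : Fin k → ℚ
  g v = f (suc v) * (if u == v then 1ℚ else 0ℚ)

ℕ→ℚ-suc : ∀ k → ℕ→ℚ (suc k) ≡ 1ℚ + ℕ→ℚ k
ℕ→ℚ-suc k rewrite normalize-coprime (coprime-sym (1-coprimeTo k)) =
  /-cong (cong (ℤ._+_ (ℤ.+ 1)) (sym (ℤ.*-identityʳ (ℤ.+ k)))) refl

ℕ→ℚ-count : ∀ {k} (p : Fin k → Bool) → ℕ→ℚ (count p) ≡ Σ[ (λ i → if p i then 1ℚ else 0ℚ) ]
ℕ→ℚ-count {zero}  p = refl
ℕ→ℚ-count {suc k} p with p zero
... | true  = trans (ℕ→ℚ-suc (count (p ∘ suc))) (cong (_+_ 1ℚ) (ℕ→ℚ-count (p ∘ suc)))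
... | false = trans (ℕ→ℚ-count (p ∘ suc)) (sym (+-identityˡ _))

p≤∣p∣ : ∀ p → p ≤ ∣ p ∣
p≤∣p∣ p with ≤-total 0ℚ p
... | inj₁ 0≤p = ≤-reflexive (sym (0≤p⇒∣p∣≡p 0≤p))
... | inj₂ p≤0 = ≤-trans p≤0 (0≤∣p∣ p)

q≤p⇒0≤p-q : ∀ {p q} → q ≤ p → 0ℚ ≤ p - q
q≤p⇒0≤p-q {p} {q} q≤p = subst (_≤ p - q) (+-inverseʳ q) (+-monoˡ-≤ (- q) q≤p)

q≤p⇒∣p-q∣≡p-q : ∀ {p q} → q ≤ p → ∣ p - q ∣ ≡ p - q
q≤p⇒∣p-q∣≡p-q = 0≤p⇒∣p∣≡p ∘ q≤p⇒0≤p-q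

∣p-q∣≡∣q-p∣ : ∀ p q → ∣ p - q ∣ ≡ ∣ q - p ∣
∣p-q∣≡∣q-p∣ p q = trans (cong ∣_∣ (sym (⁻¹-anti-homo‿- q p))) (∣-p∣≡∣p∣ (q - p))

≤⇒≯ : ∀ {p q} → p ≤ q → ¬ q < p
≤⇒≯ p≤q q<p = <-irrefl refl (<-≤-trans q<p p≤q)

p+q<r+s⇒p<r⊎q<s : ∀ {p q r s} → p + q < r + s → p < r ⊎ q < s
p+q<r+s⇒p<r⊎q<s {p} {q} {r} {s} p+q<r+s with p <? r | q <? s
... | yes p<r | _       = inj₁ p<r
... | no _    | yes q<s = inj₂ q<s
... | no p≮r  | no q≮s  = contradiction p+q<r+s (≤⇒≯ (+-mono-≤ (≮⇒≥ p≮r) (≮⇒≥ q≮s)))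

argmin-over : ∀ {k} {P : Fin k → Set} → Decidable P → (f : Fin k → ℚ) →
              (∀ v → ¬ P v) ⊎ ∃ λ u → P u × (∀ v → P v → f u ≤ f v)
argmin-over {zero}  P? f = inj₁ λ ()
argmin-over {suc k} P? f with argmin-over (P? ∘ suc) (f ∘ suc) | P? zero
... | inj₁ none | no ¬P0 = inj₁ λ { zero → ¬P0 ; (suc v) → none v }
... | inj₁ none | yes P0 =
  inj₂ (zero , P0 , λ { zero _ → ≤-refl ; (suc v) Pv → contradiction Pv (none v) })
... | inj₂ (u , Pu , min) | no ¬P0 =
  inj₂ (suc u , Pu , λ { zero P0 → contradiction P0 ¬P0 ; (suc v) → min v })
... | inj₂ (u , Pu , min) | yes P0 with ≤-total (f zero) (f (suc u))
...   | inj₁ f0≤fu =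
  inj₂ (zero , P0 , λ { zero _ → ≤-refl ; (suc v) Pv → ≤-trans f0≤fu (min v Pv) })
...   | inj₂ fu≤f0 = inj₂ (suc u , Pu , λ { zero _ → fu≤f0 ; (suc v) → min v })

p<q-r⇔p+r<q : ∀ p q r → p < q - r ⇔ p + r < q
p<q-r⇔p+r<q p q r = mk⇔
  (λ p<q-r → subst (p + r <_) ([q-r]+r≡q q r) (+-monoˡ-< r p<q-r))
  (λ p+r<q → subst (_< q - r) ([p+r]-r≡p p r) (+-monoˡ-< (- r) p+r<q))
  where
  [q-r]+r≡q : ∀ q r → q - r + r ≡ q
  [q-r]+r≡q = solve-∀ ℚ-ring
  [p+r]-r≡p : ∀ p r → p + r - r ≡ p
  [p+r]-r≡p = solve-∀ ℚ-ring

p<-q⇔q<-p : ∀ p q → p < - q ⇔ q < - p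
p<-q⇔q<-p p q = mk⇔ flip flip
  where
  flip : ∀ {p q} → p < - q → q < - p
  flip {p} {q} p<-q = subst (_< - p) (-‿involutive q) (neg-antimono-< p<-q)

_⁺ _⁻ : ℚ → ℚ
p ⁺ = p ⊔ 0ℚ
p ⁻ = (- p) ⁺

⁺-nonneg : ∀ p → 0ℚ ≤ p ⁺
⁺-nonneg p = p≤q⊔p p 0ℚ

⁻-nonneg : ∀ p → 0ℚ ≤ p ⁻
⁻-nonneg p = ⁺-nonneg (- p)

nonneg-parts : ∀ {p} → 0ℚ ≤ p → p ⁺ ≡ p × p ⁻ ≡ 0ℚ
nonneg-parts 0≤p = p≥q⇒p⊔q≡p 0≤p , p≤q⇒p⊔q≡q (neg-antimono-≤ 0≤p)

nonpos-parts : ∀ {p} → p ≤ 0ℚ → p ⁺ ≡ 0ℚ × p ⁻ ≡ - p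
nonpos-parts p≤0 = p≤q⇒p⊔q≡q p≤0 , p≥q⇒p⊔q≡p (neg-antimono-≤ p≤0)

*-split : ∀ p q → p * q ≡ p ⁺ * q + p ⁻ * (- q)
*-split p q with ≤-total 0ℚ p
... | inj₁ 0≤p rewrite proj₁ (nonneg-parts 0≤p) | proj₂ (nonneg-parts 0≤p) = pq≡pq+0[-q] p q
  where
  pq≡pq+0[-q] : ∀ p q → p * q ≡ p * q + 0ℚ * (- q)
  pq≡pq+0[-q] = solve-∀ ℚ-ring
... | inj₂ p≤0 rewrite proj₁ (nonpos-parts p≤0) | proj₂ (nonpos-parts p≤0) = pq≡0q+[-p][-q] p q
  where
  pq≡0q+[-p][-q] : ∀ p q → p * q ≡ 0ℚ * q + (- p) * (- q)
  pq≡0q+[-p][-q] = solve-∀ ℚ-ring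

∣-∣-split-across : ∀ {p q} → 0ℚ ≤ p → q ≤ 0ℚ → ∣ p - q ∣ ≡ ∣ p ⁺ - q ⁺ ∣ + ∣ p ⁻ - q ⁻ ∣
∣-∣-split-across {p} {q} 0≤p q≤0
  rewrite proj₁ (nonneg-parts 0≤p) | proj₂ (nonneg-parts 0≤p)
        | proj₁ (nonpos-parts q≤0) | proj₂ (nonpos-parts q≤0) = begin
  ∣ p - q ∣
    ≡⟨ q≤p⇒∣p-q∣≡p-q (≤-trans q≤0 0≤p) ⟩
  p - q
    ≡⟨ p-q≡[p-0]+[-q-0] p q ⟩
  (p - 0ℚ) + (- q - 0ℚ)
    ≡⟨ cong₂ _+_ (q≤p⇒∣p-q∣≡p-q 0≤p) (q≤p⇒∣p-q∣≡p-q (neg-antimono-≤ q≤0)) ⟨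
  ∣ p - 0ℚ ∣ + ∣ - q - 0ℚ ∣
    ≡⟨ cong (_+_ ∣ p - 0ℚ ∣) (∣p-q∣≡∣q-p∣ (- q) 0ℚ) ⟩
  ∣ p - 0ℚ ∣ + ∣ 0ℚ - - q ∣ ∎
  where
  open ≡-Reasoning
  p-q≡[p-0]+[-q-0] : ∀ p q → p - q ≡ (p - 0ℚ) + (- q - 0ℚ)
  p-q≡[p-0]+[-q-0] = solve-∀ ℚ-ring

∣-∣-split : ∀ p q → ∣ p - q ∣ ≡ ∣ p ⁺ - q ⁺ ∣ + ∣ p ⁻ - q ⁻ ∣
∣-∣-split p q with ≤-total 0ℚ p | ≤-total 0ℚ q
... | inj₁ 0≤p | inj₁ 0≤q
  rewrite proj₁ (nonneg-parts 0≤p) | proj₂ (nonneg-parts 0≤p)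
        | proj₁ (nonneg-parts 0≤q) | proj₂ (nonneg-parts 0≤q) = sym (+-identityʳ ∣ p - q ∣)
... | inj₂ p≤0 | inj₂ q≤0
  rewrite proj₁ (nonpos-parts p≤0) | proj₂ (nonpos-parts p≤0)
        | proj₁ (nonpos-parts q≤0) | proj₂ (nonpos-parts q≤0) =
  trans (sym (∣-p∣≡∣p∣ (p - q)))
    (trans (cong ∣_∣ (-[p-q]≡-p--q p q)) (sym (+-identityˡ ∣ - p - - q ∣)))
  where
  -[p-q]≡-p--q : ∀ p q → - (p - q) ≡ - p - - q
  -[p-q]≡-p--q = solve-∀ ℚ-ring
... | inj₁ 0≤p | inj₂ q≤0 = ∣-∣-split-across 0≤p q≤0
... | inj₂ p≤0 | inj₁ 0≤q =
  trans (∣p-q∣≡∣q-p∣ p q)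
    (trans (∣-∣-split-across 0≤q p≤0)
      (cong₂ _+_ (∣p-q∣≡∣q-p∣ (q ⁺) (p ⁺)) (∣p-q∣≡∣q-p∣ (q ⁻) (p ⁻))))

<⁺⇔< : ∀ {x} p → 0ℚ ≤ x → x < p ⁺ ⇔ x < p
<⁺⇔< {x} p 0≤x with ≤-total 0ℚ p
... | inj₁ 0≤p rewrite proj₁ (nonneg-parts 0≤p) = mk⇔ id id
... | inj₂ p≤0 rewrite proj₁ (nonpos-parts p≤0) =
  mk⇔ (λ x<0 → contradiction x<0 (≤⇒≯ 0≤x))
      (λ x<p → contradiction x<p (≤⇒≯ (≤-trans p≤0 0≤x)))

peel : ℚ → ℚ → ℚ
peel t p = if does (0ℚ <? p) then p - t else p

peel-* : ∀ t p q → p * q ≡ peel t p * q + t * (if does (0ℚ <? p) then q else 0ℚ)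
peel-* t p q = by-sign (0ℚ <? p)
  where
  pq≡[p-t]q+tq : ∀ p q t → p * q ≡ (p - t) * q + t * q
  pq≡[p-t]q+tq = solve-∀ ℚ-ring
  pq≡pq+t0 : ∀ p q t → p * q ≡ p * q + t * 0ℚ
  pq≡pq+t0 = solve-∀ ℚ-ring
  by-sign : (0<p? : Dec (0ℚ < p)) →
            p * q ≡ (if does 0<p? then p - t else p) * q + t * (if does 0<p? then q else 0ℚ)
  by-sign (yes _) = pq≡[p-t]q+tq p q t
  by-sign (no _)  = pq≡pq+t0 p q t

∣-∣-peel-across : ∀ {t p q} → 0ℚ ≤ t → t ≤ p → q ≤ 0ℚ → ∣ p - q ∣ ≡ ∣ (p - t) - q ∣ + t * 1ℚ
∣-∣-peel-across {t} {p} {q} 0≤t t≤p q≤0 = begin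
  ∣ p - q ∣
    ≡⟨ q≤p⇒∣p-q∣≡p-q (≤-trans q≤0 (≤-trans 0≤t t≤p)) ⟩
  p - q
    ≡⟨ p-q≡[p-t-q]+t p q t ⟩
  (p - t) - q + t
    ≡⟨ cong₂ _+_ (q≤p⇒∣p-q∣≡p-q (≤-trans q≤0 (q≤p⇒0≤p-q t≤p))) (*-identityʳ t) ⟨
  ∣ (p - t) - q ∣ + t * 1ℚ ∎
  where
  open ≡-Reasoning
  p-q≡[p-t-q]+t : ∀ p q t → p - q ≡ (p - t) - q + t
  p-q≡[p-t-q]+t = solve-∀ ℚ-ring

∣-∣-peel : ∀ {t p q} → 0ℚ ≤ t → (0ℚ < p → t ≤ p) → (0ℚ < q → t ≤ q) →
           ∣ p - q ∣ ≡ ∣ peel t p - peel t q ∣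
                       + t * (if does (0ℚ <? p) xor does (0ℚ <? q) then 1ℚ else 0ℚ)
∣-∣-peel {t} {p} {q} 0≤t gap-p gap-q = by-signs (0ℚ <? p) (0ℚ <? q)
  where
  p-q≡[p-t]-[q-t] : ∀ p q t → p - q ≡ (p - t) - (q - t)
  p-q≡[p-t]-[q-t] = solve-∀ ℚ-ring
  x≡x+t0 : ∀ x → x ≡ x + t * 0ℚ
  x≡x+t0 x = sym (trans (cong (_+_ x) (*-zeroʳ t)) (+-identityʳ x))
  by-signs : (0<p? : Dec (0ℚ < p)) (0<q? : Dec (0ℚ < q)) →
             ∣ p - q ∣ ≡ ∣ (if does 0<p? then p - t else p) - (if does 0<q? then q - t else q) ∣
                         + t * (if does 0<p? xor does 0<q? then 1ℚ else 0ℚ)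
  by-signs (yes _) (yes _) =
    trans (cong ∣_∣ (p-q≡[p-t]-[q-t] p q t)) (x≡x+t0 ∣ (p - t) - (q - t) ∣)
  by-signs (no _)  (no _)  = x≡x+t0 ∣ p - q ∣
  by-signs (yes 0<p) (no 0≮q) = ∣-∣-peel-across 0≤t (gap-p 0<p) (≮⇒≥ 0≮q)
  by-signs (no 0≮p) (yes 0<q) =
    trans (∣p-q∣≡∣q-p∣ p q)
      (trans (∣-∣-peel-across 0≤t (gap-q 0<q) (≮⇒≥ 0≮p))
        (cong (_+ t * 1ℚ) (∣p-q∣≡∣q-p∣ (q - t) p)))

peel-nonneg : ∀ {t p} → 0ℚ ≤ p → (0ℚ < p → t ≤ p) → 0ℚ ≤ peel t p
peel-nonneg {t} {p} 0≤p gap = by-sign (0ℚ <? p)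
  where
  by-sign : (0<p? : Dec (0ℚ < p)) → 0ℚ ≤ (if does 0<p? then p - t else p)
  by-sign (yes 0<p) = q≤p⇒0≤p-q (gap 0<p)
  by-sign (no _)    = 0≤p

peel-pos⇒pos : ∀ {t p} → 0ℚ < peel t p → 0ℚ < p
peel-pos⇒pos {t} {p} = by-sign (0ℚ <? p)
  where
  by-sign : (0<p? : Dec (0ℚ < p)) → 0ℚ < (if does 0<p? then p - t else p) → 0ℚ < p
  by-sign (yes 0<p) _ = 0<p
  by-sign (no _)      = id

peel-self : ∀ {t} → 0ℚ < t → peel t t ≡ 0ℚ
peel-self {t} 0<t =
  trans (cong (if_then t - t else t) (dec-true (0ℚ <? t) 0<t)) (+-inverseʳ t)

<-peel⇔ : ∀ {x t} p → 0ℚ ≤ x → 0ℚ ≤ t → x < peel t p ⇔ x + t < p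
<-peel⇔ {x} {t} p 0≤x 0≤t = by-sign (0ℚ <? p)
  where
  by-sign : (0<p? : Dec (0ℚ < p)) → x < (if does 0<p? then p - t else p) ⇔ x + t < p
  by-sign (yes _)   = p<q-r⇔p+r<q x p t
  by-sign (no 0≮p) =
    mk⇔ (λ x<p → contradiction x<p (≤⇒≯ (≤-trans (≮⇒≥ 0≮p) 0≤x)))
        (λ x+t<p → contradiction x+t<p (≤⇒≯ (≤-trans (≮⇒≥ 0≮p) (+-mono-≤ 0≤x 0≤t))))

superlevel sublevel : ∀ {n} → (Fin n → ℚ) → ℚ → Subset n
superlevel ψ x = tabulate (λ v → does (x <? ψ v))
sublevel   ψ x = tabulate (λ v → does (ψ v <? x))

module _ {n : ℕ} (ψ : Fin n → ℚ) {x : ℚ} {v : Fin n} where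

  ∈-superlevel⁺ : x < ψ v → v ∈ superlevel ψ x
  ∈-superlevel⁺ x<ψv =
    lookup⇒[]= v _ (trans (lookup∘tabulate _ v) (dec-true (x <? ψ v) x<ψv))

  ∈-superlevel⁻ : v ∈ superlevel ψ x → x < ψ v
  ∈-superlevel⁻ v∈S =
    by-decision (x <? ψ v) (trans (sym (lookup∘tabulate _ v)) ([]=⇒lookup v∈S))
    where
    by-decision : (x<ψv? : Dec (x < ψ v)) → does x<ψv? ≡ true → x < ψ v
    by-decision (yes x<ψv) _ = x<ψv

superlevel-peel : ∀ {n} (ψ : Fin n → ℚ) {x t} → 0ℚ ≤ x → 0ℚ ≤ t →
                  superlevel (peel t ∘ ψ) x ≡ superlevel ψ (x + t)
superlevel-peel ψ {x} {t} 0≤x 0≤t =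
  tabulate-cong (λ v → does-⇔ (<-peel⇔ (ψ v) 0≤x 0≤t) (x <? peel t (ψ v)) (x + t <? ψ v))

peel-shrinks-support : ∀ {n} (ψ : Fin n → ℚ) {u} → 0ℚ < ψ u →
                       Subset.∣ superlevel (peel (ψ u) ∘ ψ) 0ℚ ∣ <ℕ Subset.∣ superlevel ψ 0ℚ ∣
peel-shrinks-support {n} ψ {u} 0<ψu = p⊂q⇒∣p∣<∣q∣
  ( ∈-superlevel⁺ ψ ∘ peel-pos⇒pos ∘ ∈-superlevel⁻ ψ′
  , u , ∈-superlevel⁺ ψ 0<ψu , <-irrefl (sym (peel-self 0<ψu)) ∘ ∈-superlevel⁻ ψ′ )
  where
  ψ′ : Fin n → ℚ
  ψ′ = peel (ψ u) ∘ ψ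

superlevel-⁺ : ∀ {n} (φ : Fin n → ℚ) {x} → 0ℚ ≤ x → superlevel (_⁺ ∘ φ) x ≡ superlevel φ x
superlevel-⁺ φ {x} 0≤x =
  tabulate-cong (λ v → does-⇔ (<⁺⇔< (φ v) 0≤x) (x <? φ v ⁺) (x <? φ v))

superlevel-⁻ : ∀ {n} (φ : Fin n → ℚ) {x} → 0ℚ ≤ x → superlevel (_⁻ ∘ φ) x ≡ sublevel φ (- x)
superlevel-⁻ φ {x} 0≤x =
  tabulate-cong (λ v → does-⇔ (Equivalence.trans (<⁺⇔< (- φ v) 0≤x) (p<-q⇔q<-p x (φ v)))
                               (x <? φ v ⁻) (φ v <? - x))

flow-* : ∀ p q →
         (if does (q <? p) then 1ℚ else (if does (p <? q) then - 1ℚ else 0ℚ)) * (p - q) ≡ ∣ p - q ∣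
flow-* p q = by-order (q <? p) (p <? q)
  where
  by-order : (q<p? : Dec (q < p)) (p<q? : Dec (p < q)) →
             (if does q<p? then 1ℚ else (if does p<q? then - 1ℚ else 0ℚ)) * (p - q) ≡ ∣ p - q ∣
  by-order (yes q<p) _ = trans (*-identityˡ (p - q)) (sym (q≤p⇒∣p-q∣≡p-q (<⇒≤ q<p)))
  by-order (no _) (yes p<q) = begin
    - 1ℚ * (p - q) ≡⟨ -1*x≈-x (p - q) ⟩
    - (p - q)      ≡⟨ ⁻¹-anti-homo‿- p q ⟩
    q - p          ≡⟨ q≤p⇒∣p-q∣≡p-q (<⇒≤ p<q) ⟨
    ∣ q - p ∣      ≡⟨ ∣p-q∣≡∣q-p∣ q p ⟩
    ∣ p - q ∣      ∎
    where open ≡-Reasoning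
  by-order (no q≮p) (no p≮q) rewrite ≤-antisym (≮⇒≥ q≮p) (≮⇒≥ p≮q) | +-inverseʳ q =
    *-zeroˡ 0ℚ

module _ {n : ℕ} (G : Graph n) where

  _·_ : (Fin n → ℚ) → (Fin n → ℚ) → ℚ
  _·_ = ⟪_,_⟫ G

  variation : (Fin n → ℚ) → ℚ
  variation ψ = Σ[ (λ e → ∣ ψ (tl G e) - ψ (hd G e) ∣) ]

  Certificate : (b ψ : Fin n → ℚ) → Set
  Certificate b ψ = variation ψ < ψ · b

  Violated : (b : Fin n → ℚ) → Subset n → Set
  Violated b S = ℕ→ℚ (δ G S) < bOf G b S

  bOf-tabulate : ∀ b (P : Fin n → Bool) →
                 bOf G b (tabulate P) ≡ Σ[ (λ v → if P v then b v else 0ℚ) ]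
  bOf-tabulate b P = Σ-cong (λ v → cong (if_then b v else 0ℚ) (lookup∘tabulate P v))

  δ-tabulate : ∀ (P : Fin n → Bool) →
               ℕ→ℚ (δ G (tabulate P)) ≡ Σ[ (λ e → if P (tl G e) xor P (hd G e) then 1ℚ else 0ℚ) ]
  δ-tabulate P =
    trans (ℕ→ℚ-count (λ e → lookup (tabulate P) (tl G e) xor lookup (tabulate P) (hd G e)))
      (Σ-cong λ e → cong₂ (λ a c → if a xor c then 1ℚ else 0ℚ)
                          (lookup∘tabulate P (tl G e)) (lookup∘tabulate P (hd G e)))

  bOf-neg : ∀ b S → bOf G (-_ ∘ b) S ≡ - bOf G b S
  bOf-neg b S =
    trans (Σ-cong (λ v → if-neg (lookup S v) (b v))) (Σ-neg (λ v → if lookup S v then b v else 0ℚ))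
    where
    if-neg : ∀ c p → (if c then - p else 0ℚ) ≡ - (if c then p else 0ℚ)
    if-neg true  p = refl
    if-neg false p = refl

  ·-Bmul : ∀ ψ f → ψ · Bmul G f ≡ Σ[ (λ e → f e * (ψ (tl G e) - ψ (hd G e))) ]
  ·-Bmul ψ f = begin
    Σ[ (λ v → ψ v * Σ[ (λ e → f e * ∂ e v) ]) ]
      ≡⟨ Σ-cong (λ v → *-distribˡ-Σ (ψ v) (λ e → f e * ∂ e v)) ⟩
    Σ[ (λ v → Σ[ (λ e → ψ v * (f e * ∂ e v)) ]) ]
      ≡⟨ Σ-comm (λ v e → ψ v * (f e * ∂ e v)) ⟩
    Σ[ (λ e → Σ[ (λ v → ψ v * (f e * ∂ e v)) ]) ]
      ≡⟨ Σ-cong (λ e → edge-term (f e) (tl G e) (hd G e)) ⟩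
    Σ[ (λ e → f e * (ψ (tl G e) - ψ (hd G e))) ] ∎
    where
    open ≡-Reasoning
    𝟙[_==_] : Fin n → Fin n → ℚ
    𝟙[ u == v ] = if u == v then 1ℚ else 0ℚ
    ∂ : Fin (m G) → Fin n → ℚ
    ∂ e v = 𝟙[ tl G e == v ] - 𝟙[ hd G e == v ]
    distribute : ∀ x c a b → x * (c * (a - b)) ≡ c * (x * a) + (- c) * (x * b)
    distribute = solve-∀ ℚ-ring
    factor : ∀ c a b → c * a + (- c) * b ≡ c * (a - b)
    factor = solve-∀ ℚ-ring
    edge-term : ∀ c u w →
                Σ[ (λ v → ψ v * (c * (𝟙[ u == v ] - 𝟙[ w == v ]))) ] ≡ c * (ψ u - ψ w)
    edge-term c u w = begin
      Σ[ (λ v → ψ v * (c * (𝟙[ u == v ] - 𝟙[ w == v ]))) ]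
        ≡⟨ Σ-cong (λ v → distribute (ψ v) c 𝟙[ u == v ] 𝟙[ w == v ]) ⟩
      Σ[ (λ v → c * (ψ v * 𝟙[ u == v ]) + (- c) * (ψ v * 𝟙[ w == v ])) ]
        ≡⟨ Σ-distrib-+ (λ v → c * (ψ v * 𝟙[ u == v ])) (λ v → (- c) * (ψ v * 𝟙[ w == v ])) ⟩
      Σ[ (λ v → c * (ψ v * 𝟙[ u == v ])) ] + Σ[ (λ v → (- c) * (ψ v * 𝟙[ w == v ])) ]
        ≡⟨ cong₂ _+_ (*-distribˡ-Σ c (λ v → ψ v * 𝟙[ u == v ]))
                     (*-distribˡ-Σ (- c) (λ v → ψ v * 𝟙[ w == v ])) ⟨
      c * Σ[ (λ v → ψ v * 𝟙[ u == v ]) ] + (- c) * Σ[ (λ v → ψ v * 𝟙[ w == v ]) ]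
        ≡⟨ cong₂ (λ a b → c * a + (- c) * b) (Σ-indicator ψ u) (Σ-indicator ψ w) ⟩
      c * ψ u + (- c) * ψ w
        ≡⟨ factor c (ψ u) (ψ w) ⟩
      c * (ψ u - ψ w) ∎

  ·-Bmul-flowOf : ∀ ψ → ψ · Bmul G (flowOf G ψ) ≡ variation ψ
  ·-Bmul-flowOf ψ =
    trans (·-Bmul ψ (flowOf G ψ)) (Σ-cong (λ e → flow-* (ψ (tl G e)) (ψ (hd G e))))

  certificate-split : ∀ b φ → Certificate b φ →
                      Certificate b (_⁺ ∘ φ) ⊎ Certificate (-_ ∘ b) (_⁻ ∘ φ)
  certificate-split b φ = p+q<r+s⇒p<r⊎q<s ∘ subst₂ _<_ variation-split ·-split
    where
    variation-split : variation φ ≡ variation (_⁺ ∘ φ) + variation (_⁻ ∘ φ)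
    variation-split = trans (Σ-cong (λ e → ∣-∣-split (φ (tl G e)) (φ (hd G e))))
      (Σ-distrib-+ (λ e → ∣ φ (tl G e) ⁺ - φ (hd G e) ⁺ ∣)
                   (λ e → ∣ φ (tl G e) ⁻ - φ (hd G e) ⁻ ∣))
    ·-split : φ · b ≡ (_⁺ ∘ φ) · b + (_⁻ ∘ φ) · (-_ ∘ b)
    ·-split = trans (Σ-cong (λ v → *-split (φ v) (b v)))
      (Σ-distrib-+ (λ v → φ v ⁺ * b v) (λ v → φ v ⁻ * - b v))

  ·-peel : ∀ b ψ t → ψ · b ≡ (peel t ∘ ψ) · b + t * bOf G b (superlevel ψ 0ℚ)
  ·-peel b ψ t = begin
    ψ · b
      ≡⟨ Σ-cong (λ v → peel-* t (ψ v) (b v)) ⟩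
    Σ[ (λ v → peel t (ψ v) * b v + t * 𝟙b v) ]
      ≡⟨ Σ-+-* (λ v → peel t (ψ v) * b v) t 𝟙b ⟩
    (peel t ∘ ψ) · b + t * Σ[ 𝟙b ]
      ≡⟨ cong (λ s → (peel t ∘ ψ) · b + t * s) (bOf-tabulate b _) ⟨
    (peel t ∘ ψ) · b + t * bOf G b (superlevel ψ 0ℚ) ∎
    where
    open ≡-Reasoning
    𝟙b : Fin n → ℚ
    𝟙b v = if does (0ℚ <? ψ v) then b v else 0ℚ

  variation-peel : ∀ ψ {t} → 0ℚ ≤ t → (∀ v → 0ℚ < ψ v → t ≤ ψ v) →
                   variation ψ ≡ variation (peel t ∘ ψ) + t * ℕ→ℚ (δ G (superlevel ψ 0ℚ))
  variation-peel ψ {t} 0≤t gap = begin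
    variation ψ
      ≡⟨ Σ-cong (λ e → ∣-∣-peel 0≤t (gap (tl G e)) (gap (hd G e))) ⟩
    Σ[ (λ e → ∣ peel t (ψ (tl G e)) - peel t (ψ (hd G e)) ∣ + t * cut e) ]
      ≡⟨ Σ-+-* (λ e → ∣ peel t (ψ (tl G e)) - peel t (ψ (hd G e)) ∣) t cut ⟩
    variation (peel t ∘ ψ) + t * Σ[ cut ]
      ≡⟨ cong (λ s → variation (peel t ∘ ψ) + t * s) (δ-tabulate _) ⟨
    variation (peel t ∘ ψ) + t * ℕ→ℚ (δ G (superlevel ψ 0ℚ)) ∎
    where
    open ≡-Reasoning
    cut : Fin (m G) → ℚ
    cut e = if does (0ℚ <? ψ (tl G e)) xor does (0ℚ <? ψ (hd G e)) then 1ℚ else 0ℚ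

  peel-certificate : ∀ b ψ {t} → 0ℚ ≤ t → (∀ v → 0ℚ < ψ v → t ≤ ψ v) → Certificate b ψ →
                     ¬ Violated b (superlevel ψ 0ℚ) → Certificate b (peel t ∘ ψ)
  peel-certificate b ψ {t} 0≤t gap cert ¬violated
    with p+q<r+s⇒p<r⊎q<s (subst₂ _<_ (variation-peel ψ 0≤t gap) (·-peel b ψ t) cert)
  ... | inj₁ cert′ = cert′
  ... | inj₂ tδ<tb =
    contradiction tδ<tb (≤⇒≯ (*-monoˡ-≤-nonNeg t {{nonNegative 0≤t}} (≮⇒≥ ¬violated)))

  zero-not-certificate : ∀ b ψ → (∀ v → ψ v ≡ 0ℚ) → ¬ Certificate b ψ
  zero-not-certificate b ψ ψ≡0 = <-irrefl (trans variation≡0 (sym ·≡0))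
    where
    variation≡0 : variation ψ ≡ 0ℚ
    variation≡0 = trans (Σ-cong (λ e → cong₂ (λ p q → ∣ p - q ∣) (ψ≡0 (tl G e)) (ψ≡0 (hd G e))))
                        (Σ-zero {m G})
    ·≡0 : ψ · b ≡ 0ℚ
    ·≡0 = trans (Σ-cong (λ v → trans (cong (_* b v) (ψ≡0 v)) (*-zeroˡ (b v)))) (Σ-zero {n})

  violated-superlevel : ∀ b ψ → (∀ v → 0ℚ ≤ ψ v) → Certificate b ψ →
                        ∃ λ x → 0ℚ ≤ x × Violated b (superlevel ψ x)
  violated-superlevel b ψ = go ψ (<-wellFounded _)
    where
    go : ∀ ψ → Acc _<ℕ_ (Subset.∣ superlevel ψ 0ℚ ∣) → (∀ v → 0ℚ ≤ ψ v) → Certificate b ψ →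
         ∃ λ x → 0ℚ ≤ x × Violated b (superlevel ψ x)
    go ψ (acc smaller) ψ≥0 cert with argmin-over (λ v → 0ℚ <? ψ v) ψ
    ... | inj₁ ψ≯0 =
      contradiction cert (zero-not-certificate b ψ (λ v → ≤-antisym (≮⇒≥ (ψ≯0 v)) (ψ≥0 v)))
    ... | inj₂ (u , 0<t , least) with ℕ→ℚ (δ G (superlevel ψ 0ℚ)) <? bOf G b (superlevel ψ 0ℚ)
    ...   | yes violated = 0ℚ , ≤-refl , violated
    ...   | no ¬violated =
      let x , 0≤x , violated = go (peel (ψ u) ∘ ψ) (smaller (peel-shrinks-support ψ 0<t))
                                  (λ v → peel-nonneg (ψ≥0 v) (least v))
                                  (peel-certificate b ψ (<⇒≤ 0<t) least cert ¬violated)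
      in x + ψ u , +-mono-≤ 0≤x (<⇒≤ 0<t) ,
         subst (Violated b) (superlevel-peel ψ 0≤x (<⇒≤ 0<t)) violated

  violated⇒δ<∣bOf∣ : ∀ b S → Violated b S → ℕ→ℚ (δ G S) < ∣ bOf G b S ∣
  violated⇒δ<∣bOf∣ b S violated = <-≤-trans violated (p≤∣p∣ (bOf G b S))

  violated-neg⇒δ<∣bOf∣ : ∀ b S → Violated (-_ ∘ b) S → ℕ→ℚ (δ G S) < ∣ bOf G b S ∣
  violated-neg⇒δ<∣bOf∣ b S violated =
    subst (ℕ→ℚ (δ G S) <_) (trans (cong ∣_∣ (bOf-neg b S)) (∣-p∣≡∣p∣ (bOf G b S)))
      (violated⇒δ<∣bOf∣ (-_ ∘ b) S violated)

  violated-level-set : ∀ b φ → Certificate b φ →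
    ∃ λ (S : Subset n) →
      (ℕ→ℚ (δ G S) < ∣ bOf G b S ∣) ×
      ((∃ λ x → 0ℚ ≤ x × IsUpperLevel G φ x S) ⊎ (∃ λ x → x ≤ 0ℚ × IsLowerLevel G φ x S))
  violated-level-set b φ cert with certificate-split b φ cert
  ... | inj₁ cert⁺ =
    let x , 0≤x , violated = violated-superlevel b (_⁺ ∘ φ) (⁺-nonneg ∘ φ) cert⁺ in
    superlevel φ x ,
    violated⇒δ<∣bOf∣ b (superlevel φ x) (subst (Violated b) (superlevel-⁺ φ 0≤x) violated) ,
    inj₁ (x , 0≤x , lookup∘tabulate _)
  ... | inj₂ cert⁻ =
    let x , 0≤x , violated = violated-superlevel (-_ ∘ b) (_⁻ ∘ φ) (⁻-nonneg ∘ φ) cert⁻ in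
    sublevel φ (- x) ,
    violated-neg⇒δ<∣bOf∣ b (sublevel φ (- x))
      (subst (Violated (-_ ∘ b)) (superlevel-⁻ φ 0≤x) violated) ,
    inj₂ (- x , neg-antimono-≤ 0≤x , lookup∘tabulate _)

lemma2p2 : ∀ {n : ℕ} (G : Graph n) (b : Fin n → ℚ) (α : ℚ) (T i : ℕ) →
    α ≤ + 1 / 4 →
    i <ℕ T →
    (∀ j → j <ℕ i → ¬ Procedure.Terminates G b α j) →
    Procedure.Terminates G b α i →
    ∃ λ (S : Subset n) →
      (ℕ→ℚ (δ G S) < ∣ bOf G b S ∣) ×
      ((∃ λ x → 0ℚ ≤ x × IsUpperLevel G (Procedure.φ̃ G b α i) x S)
       ⊎ (∃ λ x → x ≤ 0ℚ × IsLowerLevel G (Procedure.φ̃ G b α i) x S))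
lemma2p2 {n} G b α T i _ _ _ terminates =
  violated-level-set G b φ (subst (_< ⟪_,_⟫ G φ b) (·-Bmul-flowOf G φ) terminates)
  where
  φ : Fin n → ℚ
  φ = Procedure.φ̃ G b α i
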